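{- Let $G$ be a connected simple graph containing a vertex $a$ with $d_G(a)\geq 2$, fix any execution of Algorithm $\text{tree}(G)$, and let $r$, $U$ and $F$ be the rank function, set of uniquely-ranked vertices, and forest associated with this execution (as defined in the context). If $uv$ is an edge of $G$ with $u\in U$ and $v\in L(F)$, then $r(u)>r(v)$.
   Context: All graphs are finite, undirected and simple. For a graph $H$ and $u\in V(H)$, $d_H(u)$ is the number of neighbors of $u$ in $H$, and $L(H)$ is the set of vertices $u$ of $H$ with $d_H(u)=1$. For a tree $T$ that is a subgraph of $G$ and $u\in V(T)$, let $V_T(u)$ be the set of vertices $v\in V(G)\setminus V(T)$ with $uv\in E(G)$, and $E_T(u)=\{uv:v\in V_T(u)\}$; if $|V_T(u)|=1$, let $v_T(u)$ be its unique element. $T\cup E_T(u)$ is the tree obtained by adding the vertices $V_T(u)$ and edges $E_T(u)$ ("expanding $T$ at $u$"). $W_2(T)$ is the set of $u\in V(T)$ with $|V_T(u)|\geq 2$; $W_1(T)$ is the set of $u\in V(T)$ with $|V_T(u)|=1$ and $|V_{T\cup E_T(u)}(v_T(u))|\geq 2$; $W_0(T)$ is the set of $u\in V(T)$ with $|V_T(u)|=1$ and $|V_{T\cup E_T(u)}(v_T(u))|\leq 1$. Algorithm $\text{tree}(G)$: start with $T=\{a\}$; while $V(T)\neq V(G)$: if $W_2(T)\neq\varnothing$ let $u$ be an arbitrary vertex of $W_2(T)$; else if $W_1(T)\neq\varnothing$ let $u$ be an arbitrary vertex of $W_1(T)$; else let $u$ be the vertex of $W_0(T)$ that joined $V(T)$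 most recently; then set $T:=T\cup E_T(u)$. Return $T$. For a fixed execution, let $T$ be the returned spanning tree, rooted at $a$, and for $v\neq a$ let $p(v)$ be the parent of $v$ in $T$. For each vertex $u$ at which the algorithm expands the tree, let $T_u$ be the current tree immediately before that expansion (so $u=p(v)$ iff $v\in V_{T_u}(u)$). Define ranks $r:V(G)\to\mathbb{Z}$ by $r(a)=1$ and, for each edge $uv$ of $T$ with $u=p(v)$: $r(v)=r(u)$ if $u\in W_2(T_u)$, and $r(v)=1+\max_{w\in V(T_u)} r(w)$ otherwise. Let $U$ be the set of vertices $v$ of $G$ such that no other vertex of $G$ has rank $r(v)$. Let $F$ be the spanning forest obtained from $T$ by deleting every edge $uv$ with $r(u)\neq r(v)$. -}

module Defs where

open import Data.Nat using (ℕ; zero; suc; _+_; _≤_; _<_; _⊔_)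
open import Data.Nat.Base using (_≡ᵇ_)
open import Data.Fin using (Fin; zero; suc)
open import Data.Fin.Properties using () renaming (_≟_ to _≟ᶠ_)
open import Data.Bool using (Bool; true; false; if_then_else_; _∧_; _∨_; not)
open import Data.Product using (Σ; _×_; ∃-syntax; _,_)
open import Data.Sum using (_⊎_)
open import Relation.Nullary using (¬_)
open import Relation.Nullary.Decidable using (⌊_⌋)
open import Relation.Binary.PropositionalEquality using (_≡_; _≢_)

cnt : ∀ {n} → (Fin n → Bool) → ℕ
cnt {zero}  f = 0
cnt {suc n} f = (if f zero then 1 else 0) + cnt (λ i → f (suc i))

-- Maximum of g over the elements satisfying f (0 if there are none).
maxOver : ∀ {n} → (Fin n → Bool) → (Fin n → ℕ) → ℕ
maxOver {zero}  f g = 0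
maxOver {suc n} f g =
  (if f zero then g zero else 0) ⊔ maxOver (λ i → f (suc i)) (λ i → g (suc i))

record Graph : Set where
  field
    n      : ℕ
    adj    : Fin n → Fin n → Bool
    sym    : ∀ x y → adj x y ≡ adj y x
    irrefl : ∀ x → adj x x ≡ false

module _ (G : Graph) where
  open Graph G

  V : Set
  V = Fin n

  deg : V → ℕ
  deg x = cnt (adj x)

  data Walk : V → V → Set where
    here : ∀ {x} → Walk x x
    step : ∀ {x y z} → adj x y ≡ true → Walk y z → Walk x z

  Connected : Set
  Connected = ∀ x y → Walk x y

  -- States of Algorithm tree(G), started at root a.
  -- inT    : membership in V(T)
  -- time   : index of the expansion at which the vertex joined V(T)
  --          (a joins at time 0)
  -- rk     : rank r of the vertex (meaningful for vertices in T)
  -- par    : parent p(v) in T (meaningful for v ≠ a in T)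
  -- clock  : number of expansions performed so far

  record State : Set where
    field
      inT   : V → Bool
      time  : V → ℕ
      rk    : V → ℕ
      par   : V → V
      clock : ℕ
  open State public

  module _ (a : V) where

    initState : State
    initState = record
      { inT   = λ x → ⌊ x ≟ᶠ a ⌋
      ; time  = λ _ → 0
      ; rk    = λ _ → 1
      ; par   = λ x → x
      ; clock = 0
      }

    inVT : State → V → V → Bool
    inVT s u x = inT s u ∧ adj u x ∧ not (inT s x)

    sizeVT : State → V → ℕ
    sizeVT s u = cnt (inVT s u)

    maxRank : State → ℕ
    maxRank s = maxOver (inT s) (rk s)

    expand : State → V → State
    expand s u = record
      { inT   = λ x → inT s x ∨ inVT s u x
      ; time  = λ x → if inVT s u x then suc (clock s) else time s x
      ; rk    = λ x → if inVT s u x then newRank else rk s x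
      ; par   = λ x → if inVT s u x then u else par s x
      ; clock = suc (clock s)
      }
      where
      newRank : ℕ
      newRank = if 2 Data.Nat.≤ᵇ sizeVT s u then rk s u else suc (maxRank s)

    W2 : State → V → Set
    W2 s u = inT s u ≡ true × 2 ≤ sizeVT s u

    W1 : State → V → Set
    W1 s u = inT s u ≡ true × sizeVT s u ≡ 1 ×
             (∃[ v ] (inVT s u v ≡ true × 2 ≤ sizeVT (expand s u) v))

    W0 : State → V → Set
    W0 s u = inT s u ≡ true × sizeVT s u ≡ 1 ×
             (∃[ v ] (inVT s u v ≡ true × sizeVT (expand s u) v ≤ 1))

    Choice : State → V → Set
    Choice s u =
      W2 s u
      ⊎ ((∀ w → ¬ W2 s w) × W1 s u)
      ⊎ ((∀ w → ¬ W2 s w) × (∀ w → ¬ W1 s w) × W0 s u ×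
         (∀ w → W0 s w → time s w ≤ time s u))

    Complete : State → Set
    Complete s = ∀ x → inT s x ≡ true

    data Reach : State → Set where
      start : Reach initState
      next  : ∀ {s} u → Reach s → ¬ Complete s → Choice s u → Reach (expand s u)

    Unique : State → V → Set
    Unique s u = ∀ w → w ≢ u → rk s w ≢ rk s u

    -- xy is an edge of F: an edge of T (one endpoint non-root, the other
    -- its parent) whose endpoints have equal rank
    edgeF : State → V → V → Bool
    edgeF s x y =
      (not ⌊ y ≟ᶠ a ⌋ ∧ ⌊ par s y ≟ᶠ x ⌋ ∧ (rk s y Data.Nat.≡ᵇ rk s x))
      ∨ (not ⌊ x ≟ᶠ a ⌋ ∧ ⌊ par s x ≟ᶠ y ⌋ ∧ (rk s x Data.Nat.≡ᵇ rk s y))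

    degF : State → V → ℕ
    degF s x = cnt (edgeF s x)

    LeafF : State → V → Set
    LeafF s x = degF s x ≡ 1

-- A uniquely ranked u ≠ a joined T as the only new vertex of an expansion at some w (a W2
-- expansion gives its new vertices equal ranks), so r(u) exceeds every rank present before;
-- this settles the case where v was already in T.  Otherwise the algorithm must expand u next:
-- a W2 vertex could only be u, which would then pass its rank on to its children; a W1 vertex
-- other than u would already have been in W1 before the step at w, yet that step was a W0 step
-- (a W1 step at w would make u branch); and among the W0 vertices u joined last.  So v is the
-- only child of u and gets a fresh rank, hence the F-degree of v is its number of F-children.
-- That number is never 1: a W2 expansion keeps all its new vertices in the parent's
-- F-component and any other expansion keeps none.  Finally, d(a) ≥ 2 makes the first step a
-- W2 expansion at a, so a is never uniquely ranked.

module Submission where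

open import Defs
open import Data.Nat using (ℕ; zero; suc; _+_; _≤_; _<_; z≤n; s≤s; _≤ᵇ_; _≡ᵇ_)
open import Data.Nat.Properties
  using (module ≤-Reasoning; ≤⇒≤ᵇ; ≤ᵇ⇒≤; ≡ᵇ⇒≡; _≤?_; ≰⇒>; ≤-pred; ≤-antisym; ≤-trans;
         ≤-reflexive; m≤n⇒m≤1+n; m≤m⊔n; m≤n⊔m; n<1+n; 1+n≰n)
open import Data.Fin using (Fin; zero; suc)
open import Data.Fin.Properties using (suc-injective) renaming (_≟_ to _≟ᶠ_)
open import Data.Bool using (Bool; true; false; if_then_else_; _∧_; _∨_; not; T)
open import Data.Bool.Properties
  using (∧-zeroʳ; ∧-identityʳ; ∨-zeroʳ; ∨-identityʳ; ∨-inverseʳ; ¬-not)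
open import Data.Product using (_×_; ∃-syntax; _,_)
open import Data.Sum using (_⊎_; inj₁; inj₂)
open import Data.Empty using (⊥-elim)
open import Relation.Nullary using (¬_; yes; no)
open import Relation.Nullary.Decidable using (⌊_⌋; toSum)
open import Relation.Binary.PropositionalEquality

≡ᵇ-refl : ∀ m → (m ≡ᵇ m) ≡ true
≡ᵇ-refl zero    = refl
≡ᵇ-refl (suc m) = ≡ᵇ-refl m

≢⇒≡ᵇ-false : ∀ {m n} → m ≢ n → (m ≡ᵇ n) ≡ false
≢⇒≡ᵇ-false {m} {n} m≢n with m ≡ᵇ n in eq
... | false = refl
... | true  = ⊥-elim (m≢n (≡ᵇ⇒≡ m n (subst T (sym eq) _)))

≥2⇒≢1 : ∀ {n} → 2 ≤ n → n ≢ 1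
≥2⇒≢1 (s≤s ()) refl

true≢false : true ≢ false
true≢false ()

true-or-false : (b : Bool) → b ≡ true ⊎ b ≡ false
true-or-false true  = inj₁ refl
true-or-false false = inj₂ refl

-- Counting

private
  variable
    m : ℕ
    p q : Fin m → Bool

cnt-cong : (∀ i → p i ≡ q i) → cnt p ≡ cnt q
cnt-cong {zero}  p≗q = refl
cnt-cong {suc m} p≗q rewrite p≗q zero = cong (_ +_) (cnt-cong (λ i → p≗q (suc i)))

cnt-mono : (∀ i → p i ≡ true → q i ≡ true) → cnt p ≤ cnt q
cnt-mono {zero} p⊆q = z≤n
cnt-mono {suc m} {p} {q} p⊆q with p zero in p₀ | q zero in q₀
... | true  | true  = s≤s (cnt-mono (λ i → p⊆q (suc i)))
... | true  | false with () ← trans (sym (p⊆q zero p₀)) q₀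
... | false | true  = m≤n⇒m≤1+n (cnt-mono (λ i → p⊆q (suc i)))
... | false | false = cnt-mono (λ i → p⊆q (suc i))

cnt-none : (∀ i → p i ≡ false) → cnt p ≡ 0
cnt-none {zero}  none = refl
cnt-none {suc m} none rewrite none zero = cnt-none (λ i → none (suc i))

cnt-witness : 1 ≤ cnt p → ∃[ i ] p i ≡ true
cnt-witness {suc m} {p} pos with p zero in p₀
... | true  = zero , p₀
... | false with i , pᵢ ← cnt-witness pos = suc i , pᵢ

witness⇒cnt-pos : ∀ i → p i ≡ true → 1 ≤ cnt p
witness⇒cnt-pos zero pᵢ rewrite pᵢ = s≤s z≤n
witness⇒cnt-pos {p = p} (suc i) pᵢ with p zero
... | true  = s≤s z≤n
... | false = witness⇒cnt-pos i pᵢ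

witnesses⇒cnt≥2 : ∀ i j → i ≢ j → p i ≡ true → p j ≡ true → 2 ≤ cnt p
witnesses⇒cnt≥2 zero    zero    i≢j _  _  = ⊥-elim (i≢j refl)
witnesses⇒cnt≥2 zero    (suc j) _   pᵢ pⱼ rewrite pᵢ = s≤s (witness⇒cnt-pos j pⱼ)
witnesses⇒cnt≥2 (suc i) zero    _   pᵢ pⱼ rewrite pⱼ = s≤s (witness⇒cnt-pos i pᵢ)
witnesses⇒cnt≥2 {p = p} (suc i) (suc j) i≢j pᵢ pⱼ with p zero
... | true  = m≤n⇒m≤1+n (witnesses⇒cnt≥2 i j (λ e → i≢j (cong suc e)) pᵢ pⱼ)
... | false = witnesses⇒cnt≥2 i j (λ e → i≢j (cong suc e)) pᵢ pⱼ

cnt≡1⇒unique : cnt p ≡ 1 → ∀ i j → p i ≡ true → p j ≡ true → i ≡ j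
cnt≡1⇒unique one i j pᵢ pⱼ with i ≟ᶠ j
... | yes i≡j = i≡j
... | no i≢j with s≤s () ← subst (2 ≤_) one (witnesses⇒cnt≥2 i j i≢j pᵢ pⱼ)

cnt≥2⇒other-witness : 2 ≤ cnt p → ∀ j → ∃[ i ] (i ≢ j × p i ≡ true)
cnt≥2⇒other-witness {suc m} {p} two j with p zero in p₀ | j
... | true  | suc _ = zero , (λ ()) , p₀
... | true  | zero with i , pᵢ ← cnt-witness {p = λ i → p (suc i)} (≤-pred two) =
  suc i , (λ ()) , pᵢ
... | false | zero with i , pᵢ ← cnt-witness {p = λ i → p (suc i)} (≤-trans (s≤s z≤n) two) =
  suc i , (λ ()) , pᵢ
... | false | suc j with i , i≢j , pᵢ ← cnt≥2⇒other-witness two j =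
  suc i , (λ e → i≢j (suc-injective e)) , pᵢ

maxOver-upper : (r : Fin m → ℕ) → ∀ i → p i ≡ true → r i ≤ maxOver p r
maxOver-upper r zero    pᵢ rewrite pᵢ = m≤m⊔n _ _
maxOver-upper r (suc i) pᵢ =
  ≤-trans (maxOver-upper (λ j → r (suc j)) i pᵢ) (m≤n⊔m _ _)

module _ (G : Graph) (a : V G) where
  open Graph G using (adj; irrefl)

  private
    variable
      s t f : State G
      u v w x y z : V G

  -- A single expansion

  infixl 5 _⊳_
  _⊳_ : State G → V G → State G
  _⊳_ = expand G a

  Vᵀ : State G → V G → V G → Bool
  Vᵀ = inVT G a

  #Vᵀ : State G → V G → ℕ
  #Vᵀ = sizeVT G a

  rankOfNew : State G → V G → ℕ
  rankOfNew s u = if 2 ≤ᵇ #Vᵀ s u then rk s u else suc (maxRank G a s)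

  Vᵀ-intro : inT s u ≡ true → adj u x ≡ true → inT s x ≡ false → Vᵀ s u x ≡ true
  Vᵀ-intro u∈ u~x x∉ rewrite u∈ | u~x | x∉ = refl

  Vᵀ-adj : Vᵀ s u x ≡ true → adj u x ≡ true
  Vᵀ-adj {s} {u} {x} new with inT s u | adj u x
  ... | true | true = refl

  Vᵀ-∉ : Vᵀ s u x ≡ true → inT s x ≡ false
  Vᵀ-∉ {s} {u} {x} new with inT s u | adj u x | inT s x
  ... | true | true | false = refl

  Vᵀ-old : inT s x ≡ true → Vᵀ s u x ≡ false
  Vᵀ-old {s} {x} {u} x∈ rewrite x∈ = trans (cong (inT s u ∧_) (∧-zeroʳ _)) (∧-zeroʳ _)

  ∈-⊳-old : inT s x ≡ true → inT (s ⊳ u) x ≡ true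
  ∈-⊳-old x∈ rewrite x∈ = refl

  ∈-⊳-new : Vᵀ s u x ≡ true → inT (s ⊳ u) x ≡ true
  ∈-⊳-new {s} {u} {x} new rewrite new = ∨-zeroʳ (inT s x)

  ∈-⊳-adj : inT s u ≡ true → adj u x ≡ true → inT (s ⊳ u) x ≡ true
  ∈-⊳-adj {s} {u} {x} u∈ u~x rewrite u∈ | u~x = ∨-inverseʳ (inT s x)

  ∈-⊳⁻ : inT (s ⊳ u) x ≡ true → inT s x ≡ true ⊎ Vᵀ s u x ≡ true
  ∈-⊳⁻ {s} {u} {x} x∈ with inT s x
  ... | true  = inj₁ refl
  ... | false = inj₂ x∈

  ∉-⊳⁻ : inT (s ⊳ u) x ≡ false → inT s x ≡ false × Vᵀ s u x ≡ false
  ∉-⊳⁻ {s} {u} {x} x∉ with inT s x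
  ... | false = refl , x∉

  ∉-⊳ : inT s x ≡ false → Vᵀ s u x ≡ false → inT (s ⊳ u) x ≡ false
  ∉-⊳ x∉ old rewrite x∉ | old = refl

  rk-old : Vᵀ s u x ≡ false → rk (s ⊳ u) x ≡ rk s x
  rk-old old rewrite old = refl

  par-old : Vᵀ s u x ≡ false → par (s ⊳ u) x ≡ par s x
  par-old old rewrite old = refl

  time-old : Vᵀ s u x ≡ false → time (s ⊳ u) x ≡ time s x
  time-old old rewrite old = refl

  rk-new : Vᵀ s u x ≡ true → rk (s ⊳ u) x ≡ rankOfNew s u
  rk-new new rewrite new = refl

  par-new : Vᵀ s u x ≡ true → par (s ⊳ u) x ≡ u
  par-new new rewrite new = refl

  time-new : Vᵀ s u x ≡ true → time (s ⊳ u) x ≡ suc (clock s)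
  time-new new rewrite new = refl

  rk-⊳-∈ : inT s x ≡ true → rk (s ⊳ u) x ≡ rk s x
  rk-⊳-∈ {s} x∈ = rk-old {s = s} (Vᵀ-old {s = s} x∈)

  par-⊳-∈ : inT s x ≡ true → par (s ⊳ u) x ≡ par s x
  par-⊳-∈ {s} x∈ = par-old {s = s} (Vᵀ-old {s = s} x∈)

  time-⊳-∈ : inT s x ≡ true → time (s ⊳ u) x ≡ time s x
  time-⊳-∈ {s} x∈ = time-old {s = s} (Vᵀ-old {s = s} x∈)

  rankOfNew-branching : 2 ≤ #Vᵀ s u → rankOfNew s u ≡ rk s u
  rankOfNew-branching {s} {u} two with 2 ≤ᵇ #Vᵀ s u | ≤⇒≤ᵇ two
  ... | true | _ = refl

  rankOfNew-lone : ¬ 2 ≤ #Vᵀ s u → rankOfNew s u ≡ suc (maxRank G a s)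
  rankOfNew-lone {s} {u} ¬two with 2 ≤ᵇ #Vᵀ s u in two
  ... | false = refl
  ... | true  = ⊥-elim (¬two (≤ᵇ⇒≤ 2 (#Vᵀ s u) (subst T (sym two) _)))

  rk≤maxRank : inT s x ≡ true → rk s x ≤ maxRank G a s
  rk≤maxRank {s} {x} x∈ = maxOver-upper (rk s) x x∈

  ∈∉⇒≢ : inT s x ≡ true → inT s y ≡ false → x ≢ y
  ∈∉⇒≢ x∈ y∉ refl = true≢false (trans (sym x∈) y∉)

  adj⇒≢ : adj x y ≡ true → x ≢ y
  adj⇒≢ {x} x~y refl = true≢false (trans (sym x~y) (irrefl x))

  _⊆ᵀ_ : State G → State G → Set
  s ⊆ᵀ t = ∀ x → inT s x ≡ true → inT t x ≡ true

  ⊆ᵀ-⊳ : s ⊆ᵀ (s ⊳ u)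
  ⊆ᵀ-⊳ {s} x = ∈-⊳-old {s = s}

  Vᵀ-antitone : s ⊆ᵀ t → inT s u ≡ true → Vᵀ t u x ≡ true → Vᵀ s u x ≡ true
  Vᵀ-antitone {s} {t} {u} {x} s⊆t u∈ new = Vᵀ-intro {s = s} u∈ (Vᵀ-adj {s = t} new) x∉s
    where
    x∉s : inT s x ≡ false
    x∉s = ¬-not λ x∈ → true≢false (trans (sym (s⊆t x x∈)) (Vᵀ-∉ {s = t} new))

  #Vᵀ-antitone : s ⊆ᵀ t → inT s u ≡ true → #Vᵀ t u ≤ #Vᵀ s u
  #Vᵀ-antitone {s} {t} {u} s⊆t u∈ = cnt-mono (λ x → Vᵀ-antitone {s} {t} {u} {x} s⊆t u∈)

  ⊳-mono : s ⊆ᵀ t → inT s z ≡ true → (s ⊳ z) ⊆ᵀ (t ⊳ z)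
  ⊳-mono {s} {t} {z} s⊆t z∈ x x∈ with ∈-⊳⁻ {s} x∈
  ... | inj₁ old = ∈-⊳-old {s = t} {u = z} (s⊆t x old)
  ... | inj₂ new = ∈-⊳-adj {s = t} (s⊆t z z∈) (Vᵀ-adj {s = s} new)

  NoW2 : State G → Set
  NoW2 s = ∀ w → ¬ W2 G a s w

  choice-∈ : Choice G a s u → inT s u ≡ true
  choice-∈ (inj₁ (u∈ , _))                      = u∈
  choice-∈ (inj₂ (inj₁ (_ , u∈ , _)))           = u∈
  choice-∈ (inj₂ (inj₂ (_ , _ , (u∈ , _) , _))) = u∈

  choice-branching-or-lone : Choice G a s u → 2 ≤ #Vᵀ s u ⊎ (#Vᵀ s u ≡ 1 × NoW2 s)
  choice-branching-or-lone (inj₁ (_ , two))                             = inj₁ two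
  choice-branching-or-lone (inj₂ (inj₁ (noW2 , _ , one , _)))            = inj₂ (one , noW2)
  choice-branching-or-lone (inj₂ (inj₂ (noW2 , _ , (_ , one , _) , _))) = inj₂ (one , noW2)

  W1-or-W0 : inT s u ≡ true → #Vᵀ s u ≡ 1 → Vᵀ s u x ≡ true → W1 G a s u ⊎ W0 G a s u
  W1-or-W0 {s} {u} {x} u∈ one new with 2 ≤? #Vᵀ (s ⊳ u) x
  ... | yes two = inj₁ (u∈ , one , x , new , two)
  ... | no ¬two = inj₂ (u∈ , one , x , new , ≤-pred (≰⇒> ¬two))

  W1-reflect : s ⊆ᵀ t → inT s z ≡ true → ¬ 2 ≤ #Vᵀ s z → W1 G a t z → W1 G a s z
  W1-reflect {s} {t} {z} s⊆t z∈ ¬two (_ , one , y , new , two) =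
    z∈ , one′ , y , new′ , ≤-trans two (#Vᵀ-antitone {s ⊳ z} {t ⊳ z} s⊳z⊆t⊳z (∈-⊳-new {s = s} new′))
    where
    s⊳z⊆t⊳z : (s ⊳ z) ⊆ᵀ (t ⊳ z)
    s⊳z⊆t⊳z = ⊳-mono {s} {t} s⊆t z∈
    new′ : Vᵀ s z y ≡ true
    new′ = Vᵀ-antitone {s} {t} s⊆t z∈ new
    one′ : #Vᵀ s z ≡ 1
    one′ = ≤-antisym (≤-pred (≰⇒> ¬two))
                     (subst (_≤ #Vᵀ s z) one (#Vᵀ-antitone {s} {t} s⊆t z∈))

  -- The forest F

  -- edgeF s x y is FChild s x y ∨ FChild s y x by definition.
  FChild : State G → V G → V G → Bool
  FChild s x y = not ⌊ y ≟ᶠ a ⌋ ∧ ⌊ par s y ≟ᶠ x ⌋ ∧ (rk s y ≡ᵇ rk s x)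

  FChild-root : FChild s x a ≡ false
  FChild-root with a ≟ᶠ a
  ... | yes _   = refl
  ... | no a≢a = ⊥-elim (a≢a refl)

  FChild-nonparent : par s y ≢ x → FChild s x y ≡ false
  FChild-nonparent {s} {y} {x} p≢x with par s y ≟ᶠ x
  ... | no  _   = ∧-zeroʳ _
  ... | yes p≡x = ⊥-elim (p≢x p≡x)

  FChild-parent : y ≢ a → par s y ≡ x → FChild s x y ≡ (rk s y ≡ᵇ rk s x)
  FChild-parent {y} {s} {x} y≢a p≡x with y ≟ᶠ a | par s y ≟ᶠ x
  ... | no _    | yes _   = refl
  ... | yes y≡a | _       = ⊥-elim (y≢a y≡a)
  ... | _       | no p≢x = ⊥-elim (p≢x p≡x)

  FChild-cong : par s y ≡ par t y → rk s y ≡ rk t y → rk s x ≡ rk t x →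
                FChild s x y ≡ FChild t x y
  FChild-cong p r r′ rewrite p | r | r′ = refl

  degF-without-parent-edge : rk s x ≢ rk s (par s x) → degF G a s x ≡ cnt (FChild s x)
  degF-without-parent-edge {s} {x} cut = cnt-cong parent-edge-absent
    where
    drop-false-disjunct : ∀ {b c} → b ∨ (c ∧ false) ≡ b
    drop-false-disjunct {b} {c} = trans (cong (b ∨_) (∧-zeroʳ c)) (∨-identityʳ b)
    parent-edge-absent : ∀ y → edgeF G a s x y ≡ FChild s x y
    parent-edge-absent y with par s x ≟ᶠ y
    ... | yes refl rewrite ≢⇒≡ᵇ-false cut = drop-false-disjunct
    ... | no  _    = drop-false-disjunct

  -- Invariant of the algorithm

  record Invariant (s : State G) : Set where
    field
      root-∈        : inT s a ≡ true
      par-∉         : ∀ y → inT s y ≡ false → par s y ≡ y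
      par-∈         : ∀ y → inT s y ≡ true → y ≢ a → inT s (par s y) ≡ true
      -- a vertex with a child has been expanded, so all its neighbours are in T
      par-saturated : ∀ y z → inT s y ≡ true → y ≢ a →
                      adj (par s y) z ≡ true → inT s z ≡ true
      time≤clock    : ∀ x → inT s x ≡ true → time s x ≤ clock s
      FChildren≢1   : ∀ x → inT s x ≡ true → cnt (FChild s x) ≢ 1

  ∉-init : x ≢ a → inT (initState G a) x ≡ false
  ∉-init {x} x≢a with x ≟ᶠ a
  ... | no _    = refl
  ... | yes x≡a = ⊥-elim (x≢a x≡a)

  ∈-init⇒root : inT (initState G a) x ≡ true → x ≡ a
  ∈-init⇒root {x} x∈ with x ≟ᶠ a
  ... | yes x≡a = x≡a

  root-∈-init : inT (initState G a) a ≡ true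
  root-∈-init with a ≟ᶠ a
  ... | yes _   = refl
  ... | no a≢a = ⊥-elim (a≢a refl)

  init-invariant : Invariant (initState G a)
  init-invariant = record
    { root-∈        = root-∈-init
    ; par-∉         = λ _ _ → refl
    ; par-∈         = λ y y∈ y≢a → ⊥-elim (y≢a (∈-init⇒root y∈))
    ; par-saturated = λ y _ y∈ y≢a _ → ⊥-elim (y≢a (∈-init⇒root y∈))
    ; time≤clock    = λ _ _ → z≤n
    ; FChildren≢1   = λ x x∈ → subst (_≢ 1) (sym (cnt-none (no-FChild x∈))) λ ()
    }
    where
    no-FChild : inT (initState G a) x ≡ true → ∀ y → FChild (initState G a) x y ≡ false
    no-FChild {x} x∈ y with toSum (y ≟ᶠ a)
    ... | inj₁ refl = FChild-root {initState G a}
    ... | inj₂ y≢a  =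
      FChild-nonparent {initState G a} λ y≡x → y≢a (trans y≡x (∈-init⇒root x∈))

  module Expansion {s : State G} (I : Invariant s) {u z₀ : V G}
                   (u∈ : inT s u ≡ true) (z₀-new : Vᵀ s u z₀ ≡ true) where
    open Invariant I

    u-childless : y ≢ a → par s y ≢ u
    u-childless {y} y≢a p≡u with true-or-false (inT s y)
    ... | inj₁ y∈ = ∈∉⇒≢ {s} (par-saturated y z₀ y∈ y≢a u~z₀) (Vᵀ-∉ {s = s} z₀-new) refl
      where
      u~z₀ : adj (par s y) z₀ ≡ true
      u~z₀ = subst (λ p → adj p z₀ ≡ true) (sym p≡u) (Vᵀ-adj {s = s} z₀-new)
    ... | inj₂ y∉ = ∈∉⇒≢ {s} u∈ y∉ (trans (sym p≡u) (par-∉ y y∉))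

    parent-∈-or-self : y ≢ a → inT s (par s y) ≡ true ⊎ par s y ≡ y
    parent-∈-or-self {y} y≢a with true-or-false (inT s y)
    ... | inj₁ y∈ = inj₁ (par-∈ y y∈ y≢a)
    ... | inj₂ y∉ = inj₂ (par-∉ y y∉)

    FChild-⊳-old : inT s x ≡ true → x ≢ u → ∀ y → FChild (s ⊳ u) x y ≡ FChild s x y
    FChild-⊳-old {x} x∈ x≢u y with true-or-false (Vᵀ s u y)
    ... | inj₁ new =
      trans (FChild-nonparent {s ⊳ u} λ p → x≢u (trans (sym p) (par-new {s = s} new)))
            (sym (FChild-nonparent {s} λ p → ∈∉⇒≢ {s} x∈ y∉ (trans (sym p) (par-∉ y y∉))))
      where y∉ = Vᵀ-∉ {s = s} new
    ... | inj₂ old =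
      FChild-cong {s = s ⊳ u} {t = s} (par-old {s = s} old) (rk-old {s = s} old) (rk-⊳-∈ {s} x∈)

    FChild-⊳-new : Vᵀ s u x ≡ true → ∀ y → FChild (s ⊳ u) x y ≡ false
    FChild-⊳-new {x} x-new y with true-or-false (Vᵀ s u y) | toSum (y ≟ᶠ a)
    ... | inj₁ y-new | _        =
      FChild-nonparent {s ⊳ u} λ p → ∈∉⇒≢ {s} u∈ x∉ (trans (sym (par-new {s = s} y-new)) p)
      where x∉ = Vᵀ-∉ {s = s} x-new
    ... | inj₂ _     | inj₁ refl = FChild-root {s ⊳ u}
    ... | inj₂ y-old | inj₂ y≢a with parent-∈-or-self y≢a
    ...   | inj₁ p∈  =
      FChild-nonparent {s ⊳ u} λ p → ∈∉⇒≢ {s} p∈ x∉ (trans (sym (par-old {s = s} y-old)) p)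
      where x∉ = Vᵀ-∉ {s = s} x-new
    ...   | inj₂ p≡y =
      FChild-nonparent {s ⊳ u} λ p → y≢x (trans (sym p≡y) (trans (sym (par-old {s = s} y-old)) p))
      where
      y≢x : y ≢ x
      y≢x refl = true≢false (trans (sym x-new) y-old)

    FChild-⊳-self : ∀ y → FChild (s ⊳ u) u y ≡ Vᵀ s u y ∧ (rankOfNew s u ≡ᵇ rk s u)
    FChild-⊳-self y with true-or-false (Vᵀ s u y) | toSum (y ≟ᶠ a)
    ... | inj₁ new | _ = begin
      FChild (s ⊳ u) u y                    ≡⟨ FChild-parent {s = s ⊳ u} y≢a (par-new {s = s} new) ⟩
      (rk (s ⊳ u) y ≡ᵇ rk (s ⊳ u) u)        ≡⟨ cong₂ _≡ᵇ_ (rk-new {s = s} new) (rk-⊳-∈ {s} u∈) ⟩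
      (rankOfNew s u ≡ᵇ rk s u)             ≡⟨ cong (_∧ (rankOfNew s u ≡ᵇ rk s u)) new ⟨
      Vᵀ s u y ∧ (rankOfNew s u ≡ᵇ rk s u)  ∎
      where
      open ≡-Reasoning
      y≢a : y ≢ a
      y≢a y≡a = ∈∉⇒≢ {s} root-∈ (Vᵀ-∉ {s = s} new) (sym y≡a)
    ... | inj₂ old | inj₁ refl = trans (FChild-root {s ⊳ u}) (sym (cong (_∧ _) old))
    ... | inj₂ old | inj₂ y≢a  =
      trans (FChild-nonparent {s ⊳ u} λ p → u-childless y≢a (trans (sym (par-old {s = s} old)) p))
            (sym (cong (_∧ _) old))

    FChildren-⊳-self≢1 : cnt (FChild (s ⊳ u) u) ≢ 1
    FChildren-⊳-self≢1 with 2 ≤? #Vᵀ s u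
    ... | yes two = ≥2⇒≢1 (subst (2 ≤_) (sym (cnt-cong all-children)) two)
      where
      all-children : ∀ y → FChild (s ⊳ u) u y ≡ Vᵀ s u y
      all-children y = begin
        FChild (s ⊳ u) u y                    ≡⟨ FChild-⊳-self y ⟩
        Vᵀ s u y ∧ (rankOfNew s u ≡ᵇ rk s u)  ≡⟨ cong (λ r → Vᵀ s u y ∧ (r ≡ᵇ rk s u))
                                                       (rankOfNew-branching {s} two) ⟩
        Vᵀ s u y ∧ (rk s u ≡ᵇ rk s u)         ≡⟨ cong (Vᵀ s u y ∧_) (≡ᵇ-refl (rk s u)) ⟩
        Vᵀ s u y ∧ true                       ≡⟨ ∧-identityʳ _ ⟩
        Vᵀ s u y                              ∎
        where open ≡-Reasoning
    ... | no ¬two = subst (_≢ 1) (sym (cnt-none no-children)) λ ()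
      where
      rank-jumps : rankOfNew s u ≢ rk s u
      rank-jumps eq =
        1+n≰n (subst (_≤ maxRank G a s) (trans (sym eq) (rankOfNew-lone {s} ¬two)) (rk≤maxRank {s} u∈))
      no-children : ∀ y → FChild (s ⊳ u) u y ≡ false
      no-children y =
        trans (FChild-⊳-self y) (trans (cong (Vᵀ s u y ∧_) (≢⇒≡ᵇ-false rank-jumps)) (∧-zeroʳ _))

    invariant : Invariant (s ⊳ u)
    invariant = record
      { root-∈        = ∈-⊳-old {s = s} root-∈
      ; par-∉         = par-∉′
      ; par-∈         = par-∈′
      ; par-saturated = par-saturated′
      ; time≤clock    = time≤clock′
      ; FChildren≢1   = FChildren≢1′
      }
      where
      par-∉′ : ∀ y → inT (s ⊳ u) y ≡ false → par (s ⊳ u) y ≡ y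
      par-∉′ y y∉′ with y∉ , old ← ∉-⊳⁻ {s} y∉′ = trans (par-old {s = s} old) (par-∉ y y∉)

      par-∈′ : ∀ y → inT (s ⊳ u) y ≡ true → y ≢ a → inT (s ⊳ u) (par (s ⊳ u) y) ≡ true
      par-∈′ y y∈′ y≢a with ∈-⊳⁻ {s} y∈′
      ... | inj₁ y∈  = subst (λ p → inT (s ⊳ u) p ≡ true) (sym (par-⊳-∈ {s} y∈))
                             (∈-⊳-old {s = s} (par-∈ y y∈ y≢a))
      ... | inj₂ new = subst (λ p → inT (s ⊳ u) p ≡ true) (sym (par-new {s = s} new))
                             (∈-⊳-old {s = s} u∈)

      par-saturated′ : ∀ y z → inT (s ⊳ u) y ≡ true → y ≢ a →
                       adj (par (s ⊳ u) y) z ≡ true → inT (s ⊳ u) z ≡ true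
      par-saturated′ y z y∈′ y≢a p~z with ∈-⊳⁻ {s} y∈′
      ... | inj₁ y∈  = ∈-⊳-old {s = s}
                         (par-saturated y z y∈ y≢a (subst (λ p → adj p z ≡ true) (par-⊳-∈ {s} y∈) p~z))
      ... | inj₂ new = ∈-⊳-adj {s = s} u∈ (subst (λ p → adj p z ≡ true) (par-new {s = s} new) p~z)

      time≤clock′ : ∀ x → inT (s ⊳ u) x ≡ true → time (s ⊳ u) x ≤ clock (s ⊳ u)
      time≤clock′ x x∈′ with ∈-⊳⁻ {s} x∈′
      ... | inj₁ x∈  = subst (_≤ suc (clock s)) (sym (time-⊳-∈ {s} x∈)) (m≤n⇒m≤1+n (time≤clock x x∈))
      ... | inj₂ new = ≤-reflexive (time-new {s = s} new)

      FChildren≢1′ : ∀ x → inT (s ⊳ u) x ≡ true → cnt (FChild (s ⊳ u) x) ≢ 1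
      FChildren≢1′ x x∈′ with ∈-⊳⁻ {s} x∈′ | x ≟ᶠ u
      ... | inj₂ new | _        = subst (_≢ 1) (sym (cnt-none (FChild-⊳-new new))) λ ()
      ... | inj₁ _   | yes refl = FChildren-⊳-self≢1
      ... | inj₁ x∈  | no x≢u   =
        subst (_≢ 1) (sym (cnt-cong (FChild-⊳-old x∈ x≢u))) (FChildren≢1 x x∈)

  -- Runs and ranks

  data Run : State G → State G → Set where
    done : Run s s
    step : ¬ Complete G a s → Choice G a s u → Run (s ⊳ u) t → Run s t

  run-snoc : Run s t → ¬ Complete G a t → Choice G a t u → Run s (t ⊳ u)
  run-snoc done              nc ch = step nc ch done
  run-snoc (step nc′ ch′ r) nc ch = step nc′ ch′ (run-snoc r nc ch)

  reach⇒run : Reach G a s → Run (initState G a) s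
  reach⇒run start             = done
  reach⇒run (next _ r nc ch) = run-snoc (reach⇒run r) nc ch

  choice-#Vᵀ-pos : Choice G a s u → 1 ≤ #Vᵀ s u
  choice-#Vᵀ-pos {s} {u} ch with choice-branching-or-lone {s} {u} ch
  ... | inj₁ two       = ≤-trans (s≤s z≤n) two
  ... | inj₂ (one , _) = ≤-reflexive (sym one)

  invariant-⊳ : Invariant s → Choice G a s u → Invariant (s ⊳ u)
  invariant-⊳ {s} {u} I ch
    with _ , z₀-new ← cnt-witness {p = Vᵀ s u} (choice-#Vᵀ-pos {s} {u} ch) =
    Expansion.invariant I (choice-∈ {s} {u} ch) z₀-new

  run-invariant : Invariant s → Run s t → Invariant t
  run-invariant I done           = I
  run-invariant I (step _ ch r) = run-invariant (invariant-⊳ I ch) r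

  run-⊆ : Run s t → s ⊆ᵀ t
  run-⊆ done                      x x∈ = x∈
  run-⊆ (step {s} _ _ r) x x∈ = run-⊆ r x (∈-⊳-old {s = s} x∈)

  run-rk : Run s t → inT s x ≡ true → rk t x ≡ rk s x
  run-rk done              x∈ = refl
  run-rk (step {s} _ _ r) x∈ = trans (run-rk r (∈-⊳-old {s = s} x∈)) (rk-⊳-∈ {s} x∈)

  run-par : Run s t → inT s x ≡ true → par t x ≡ par s x
  run-par done              x∈ = refl
  run-par (step {s} _ _ r) x∈ = trans (run-par r (∈-⊳-old {s = s} x∈)) (par-⊳-∈ {s} x∈)

  run-joins : Run s f → inT s x ≡ false → inT f x ≡ true →
              ∃[ t ] ∃[ w ] (Run s t × Choice G a t w × Vᵀ t w x ≡ true × Run (t ⊳ w) f)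
  run-joins done                 x∉ x∈ = ⊥-elim (true≢false (trans (sym x∈) x∉))
  run-joins {s} {x = x} (step {u = w} nc ch r) x∉ x∈ with true-or-false (Vᵀ s w x)
  ... | inj₁ new = s , w , done , ch , new , r
  ... | inj₂ old with t , w′ , r₀ , ch′ , new , r′ ← run-joins r (∉-⊳ {s = s} x∉ old) x∈ =
    t , w′ , step nc ch r₀ , ch′ , new , r′

  new-vertices-share-rank : Run (s ⊳ w) f → Vᵀ s w x ≡ true → Vᵀ s w y ≡ true →
                            rk f x ≡ rk f y
  new-vertices-share-rank {s} {w} {f} {x} {y} r x-new y-new = begin
    rk f x         ≡⟨ run-rk r (∈-⊳-new {s = s} x-new) ⟩
    rk (s ⊳ w) x   ≡⟨ rk-new {s = s} x-new ⟩
    rankOfNew s w  ≡⟨ rk-new {s = s} y-new ⟨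
    rk (s ⊳ w) y   ≡⟨ run-rk r (∈-⊳-new {s = s} y-new) ⟨
    rk f y         ∎
    where open ≡-Reasoning

  branching-parent-shares-rank : inT s w ≡ true → 2 ≤ #Vᵀ s w → Run (s ⊳ w) f →
                                 Vᵀ s w y ≡ true → rk f y ≡ rk f w
  branching-parent-shares-rank {s} {w} {f} {y} w∈ two r y-new = begin
    rk f y         ≡⟨ run-rk r (∈-⊳-new {s = s} y-new) ⟩
    rk (s ⊳ w) y   ≡⟨ rk-new {s = s} y-new ⟩
    rankOfNew s w  ≡⟨ rankOfNew-branching {s} two ⟩
    rk s w         ≡⟨ rk-⊳-∈ {s} w∈ ⟨
    rk (s ⊳ w) w   ≡⟨ run-rk r (∈-⊳-old {s = s} w∈) ⟨
    rk f w         ∎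
    where open ≡-Reasoning

  branching-child-not-unique : 2 ≤ #Vᵀ s w → Vᵀ s w x ≡ true → Run (s ⊳ w) f →
                               ¬ Unique G a f x
  branching-child-not-unique {s} {w} {x} two x-new r uniq
    with y , y≢x , y-new ← cnt≥2⇒other-witness {p = Vᵀ s w} two x =
    uniq y y≢x (new-vertices-share-rank {s} {w} r y-new x-new)

  branching-parent-not-unique : inT s w ≡ true → 2 ≤ #Vᵀ s w → Run (s ⊳ w) f →
                                ¬ Unique G a f w
  branching-parent-not-unique {s} {w} w∈ two r uniq
    with y , y≢w , y-new ← cnt≥2⇒other-witness {p = Vᵀ s w} two w =
    uniq y y≢w (branching-parent-shares-rank {s} {w} w∈ two r y-new)

  Vᵀ-init-root : ∀ x → Vᵀ (initState G a) a x ≡ adj a x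
  Vᵀ-init-root x with x ≟ᶠ a
  ... | yes refl rewrite irrefl a = ∧-zeroʳ _
  ... | no _     rewrite root-∈-init = ∧-identityʳ _

  root-not-unique : 2 ≤ deg G a → Run (initState G a) f → inT f x ≡ true → x ≢ a →
                    ¬ Unique G a f a
  root-not-unique _     done                  x∈ x≢a _ = x≢a (∈-init⇒root x∈)
  root-not-unique deg≥2 (step {u = w} _ ch r) _  _
    with refl ← ∈-init⇒root (choice-∈ {initState G a} {w} ch) =
    branching-parent-not-unique {initState G a} root-∈-init two r
    where
    two : 2 ≤ #Vᵀ (initState G a) a
    two = subst (2 ≤_) (sym (cnt-cong Vᵀ-init-root)) deg≥2

  lone-expansion-∉ : #Vᵀ s w ≡ 1 → Vᵀ s w u ≡ true → adj u v ≡ true → inT s v ≡ false →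
                     inT (s ⊳ w) v ≡ false
  lone-expansion-∉ {s} {w} {u} {v} lone u-new u~v v∉ with true-or-false (Vᵀ s w v)
  ... | inj₁ v-new = ⊥-elim (adj⇒≢ u~v (cnt≡1⇒unique lone u v u-new v-new))
  ... | inj₂ v-old = ∉-⊳ {s = s} v∉ v-old

  module LoneChild
    {s f : State G} {w u v z : V G}
    (inv : Invariant s) (inv-f : Invariant f)
    (ch : Choice G a s w) (lone : #Vᵀ s w ≡ 1) (noW2 : NoW2 s) (u-new : Vᵀ s w u ≡ true)
    (u~v : adj u v ≡ true) (v∉ : inT s v ≡ false)
    (ch′ : Choice G a (s ⊳ w) z) (r : Run (s ⊳ w ⊳ z) f)
    (u-unique : Unique G a f u)
    where

    s′ : State G
    s′ = s ⊳ w

    only-u-new : Vᵀ s w x ≡ true → x ≡ u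
    only-u-new {x} new = cnt≡1⇒unique lone x u new u-new

    u∈′ : inT s′ u ≡ true
    u∈′ = ∈-⊳-new {s = s} u-new

    v-new′ : Vᵀ s′ u v ≡ true
    v-new′ = Vᵀ-intro {s = s′} u∈′ u~v (lone-expansion-∉ {s} lone u-new u~v v∉)

    old-unless-u : inT s′ x ≡ true → x ≢ u → inT s x ≡ true
    old-unless-u x∈′ x≢u with ∈-⊳⁻ {s} x∈′
    ... | inj₁ x∈  = x∈
    ... | inj₂ new = ⊥-elim (x≢u (only-u-new new))

    branching-only-at-u : inT s′ x ≡ true → 2 ≤ #Vᵀ s′ x → x ≡ u
    branching-only-at-u {x} x∈′ two with x ≟ᶠ u
    ... | yes x≡u = x≡u
    ... | no  x≢u = ⊥-elim (noW2 x (x∈ , ≤-trans two (#Vᵀ-antitone {s} {s′} (⊆ᵀ-⊳ {s}) x∈)))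
      where x∈ = old-unless-u x∈′ x≢u

    u-not-branching : ¬ 2 ≤ #Vᵀ s′ u
    u-not-branching two with choice-branching-or-lone {s′} {z} ch′
    ... | inj₂ (_ , noW2′) = noW2′ u (u∈′ , two)
    ... | inj₁ two′ with refl ← branching-only-at-u (choice-∈ {s′} {z} ch′) two′ =
      branching-parent-not-unique {s′} u∈′ two r u-unique

    u-lone : #Vᵀ s′ u ≡ 1
    u-lone = ≤-antisym (≤-pred (≰⇒> u-not-branching)) (witness⇒cnt-pos v v-new′)

    no-W1 : ∀ x → ¬ W1 G a s x
    no-W1 = W0-choice ch
      where
      W0-choice : Choice G a s w → ∀ x → ¬ W1 G a s x
      W0-choice (inj₁ (_ , two)) = ⊥-elim (≥2⇒≢1 two lone)
      W0-choice (inj₂ (inj₁ (_ , _ , _ , y , y-new , two))) =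
        ⊥-elim (u-not-branching (subst (λ y → 2 ≤ #Vᵀ s′ y) (only-u-new y-new) two))
      W0-choice (inj₂ (inj₂ (_ , noW1 , _))) = noW1

    next-is-u : z ≡ u
    next-is-u = chosen ch′
      where
      chosen : Choice G a s′ z → z ≡ u
      chosen (inj₁ (z∈′ , two)) = branching-only-at-u z∈′ two
      chosen (inj₂ (inj₁ (_ , W1z))) with z ≟ᶠ u
      ... | yes z≡u = z≡u
      ... | no  z≢u =
        ⊥-elim (no-W1 z (W1-reflect {s} {s′} (⊆ᵀ-⊳ {s}) z∈ (λ two → noW2 z (z∈ , two)) W1z))
        where z∈ = old-unless-u (choice-∈ {s′} {z} ch′) z≢u
      chosen (inj₂ (inj₂ (_ , noW1′ , _ , latest))) with z ≟ᶠ u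
      ... | yes z≡u = z≡u
      ... | no  z≢u = ⊥-elim (1+n≰n (begin
          suc (clock s)  ≡⟨ time-new {s = s} u-new ⟨
          time s′ u      ≤⟨ latest u u-W0 ⟩
          time s′ z      ≡⟨ time-⊳-∈ {s} z∈ ⟩
          time s z       ≤⟨ Invariant.time≤clock inv z z∈ ⟩
          clock s        ∎))
        where
        open ≤-Reasoning
        z∈ = old-unless-u (choice-∈ {s′} {z} ch′) z≢u
        u-W0 : W0 G a s′ u
        u-W0 with W1-or-W0 {s′} u∈′ u-lone v-new′
        ... | inj₁ W1u = ⊥-elim (noW1′ u W1u)
        ... | inj₂ W0u = W0u

    r′ : Run (s′ ⊳ u) f
    r′ = subst (λ z → Run (s′ ⊳ z) f) next-is-u r

    v-rank : rk f v ≡ suc (maxRank G a s′)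
    v-rank = begin
      rk f v                   ≡⟨ run-rk r′ (∈-⊳-new {s = s′} v-new′) ⟩
      rk (s′ ⊳ u) v            ≡⟨ rk-new {s = s′} v-new′ ⟩
      rankOfNew s′ u           ≡⟨ rankOfNew-lone {s′} u-not-branching ⟩
      suc (maxRank G a s′)     ∎
      where open ≡-Reasoning

    u-rank : rk f u ≤ maxRank G a s′
    u-rank = begin
      rk f u          ≡⟨ run-rk r′ (∈-⊳-old {s = s′} u∈′) ⟩
      rk (s′ ⊳ u) u   ≡⟨ rk-⊳-∈ {s′} u∈′ ⟩
      rk s′ u         ≤⟨ rk≤maxRank {s′} u∈′ ⟩
      maxRank G a s′  ∎
      where open ≤-Reasoning

    v-parent : par f v ≡ u
    v-parent = trans (run-par r′ (∈-⊳-new {s = s′} v-new′)) (par-new {s = s′} v-new′)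

    v-not-leaf : ¬ LeafF G a f v
    v-not-leaf leaf =
      Invariant.FChildren≢1 inv-f v (run-⊆ r′ v (∈-⊳-new {s = s′} v-new′))
        (trans (sym (degF-without-parent-edge {f} rank-jumps)) leaf)
      where
      rank-jumps : rk f v ≢ rk f (par f v)
      rank-jumps eq = 1+n≰n (subst (_≤ maxRank G a s′) u-rank≡ u-rank)
        where u-rank≡ = trans (sym (trans eq (cong (rk f) v-parent))) v-rank

  lone-child-outranks-old : Vᵀ s w u ≡ true → #Vᵀ s w ≡ 1 → Run (s ⊳ w) f →
                            inT s v ≡ true → rk f v < rk f u
  lone-child-outranks-old {s} {w} {u} {f} {v} u-new lone r v∈ = begin-strict
    rk f v               ≡⟨ run-rk r (∈-⊳-old {s = s} v∈) ⟩
    rk (s ⊳ w) v         ≡⟨ rk-⊳-∈ {s} v∈ ⟩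
    rk s v               ≤⟨ rk≤maxRank {s} v∈ ⟩
    maxRank G a s        <⟨ n<1+n _ ⟩
    suc (maxRank G a s)  ≡⟨ rankOfNew-lone {s} (λ two → ≥2⇒≢1 two lone) ⟨
    rankOfNew s w        ≡⟨ rk-new {s = s} u-new ⟨
    rk (s ⊳ w) u         ≡⟨ run-rk r (∈-⊳-new {s = s} u-new) ⟨
    rk f u               ∎
    where open ≤-Reasoning

  unique-nonroot-outranks-leaf : Run (initState G a) f → Complete G a f → adj u v ≡ true →
                                 Unique G a f u → LeafF G a f v → u ≢ a → rk f v < rk f u
  unique-nonroot-outranks-leaf {f} {u} {v} r complete u~v u-unique v-leaf u≢a
    with s , w , r₀ , ch , u-new , r₁ ← run-joins r (∉-init u≢a) (complete u)
    with choice-branching-or-lone {s} {w} ch | true-or-false (inT s v)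
  ... | inj₁ two           | _       = ⊥-elim (branching-child-not-unique {s} {w} two u-new r₁ u-unique)
  ... | inj₂ (lone , _)    | inj₁ v∈ = lone-child-outranks-old {s} {w} u-new lone r₁ v∈
  ... | inj₂ (lone , noW2) | inj₂ v∉ with r₁
  ...   | done          =
    ⊥-elim (true≢false (trans (sym (complete v)) (lone-expansion-∉ {s} lone u-new u~v v∉)))
  ...   | step _ ch′ r₂ =
    ⊥-elim (LoneChild.v-not-leaf (run-invariant init-invariant r₀) (run-invariant init-invariant r)
                                 ch lone noW2 u-new u~v v∉ ch′ r₂ u-unique v-leaf)

lemma4 : (G : Graph) (a : V G) →
         Connected G → 2 ≤ deg G a →
         (s : State G) → Reach G a s → Complete G a s →
         ∀ u v → Graph.adj G u v ≡ true →
         Unique G a s u → LeafF G a s v →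
         State.rk s v < State.rk s u
lemma4 G a _ deg≥2 s reach complete u v u~v u-unique v-leaf with reach⇒run G a reach | u ≟ᶠ a
... | run | yes refl = ⊥-elim (root-not-unique G a deg≥2 run (complete v) (≢-sym (adj⇒≢ G a u~v)) u-unique)
... | run | no u≢a   = unique-nonroot-outranks-leaf G a run complete u~v u-unique v-leaf u≢a
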